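{- The three intervals $[\mathsf{LP}\cap\mathsf{ECQ},\mathsf{LP}]$, $[\mathsf{ECQ},\mathsf{LP}\vee\mathsf{ECQ}]$ and $[\mathsf{ETL},\mathsf{CL}]$ are pairwise disjoint, and every non-trivial proper extension of $\mathsf{BD}$ lies in one of them.
   Context: Formulas are built from a countably infinite set of propositional variables using binary $\wedge,\vee$, unary ${\sim}$ (De Morgan negation) and constants $\top,\bot$. A logic is a set of rules $\Gamma\vdash\varphi$ ($\Gamma$ a set of formulas) closed under reflexivity, monotonicity, cut and substitution. $L_1\le L_2$ means $L_1\subseteq L_2$; an extension of $L$ is a logic containing $L$; the extension of $L$ by a set of rules is the least logic containing both; $L_1\vee L_2$ is the least logic containing $L_1\cup L_2$; the trivial logic contains all rules; $[L_1,L_2]$ is the set of logics $L$ with $L_1\le L\le L_2$. A matrix $\langle A,F\rangle$ is an algebra of this signature with $F\subseteq A$; a rule $\Gamma\vdash\varphi$ is valid in it if every valuation (homomorphism from formulas into $A$) sending $\Gamma$ into $F$ sends $\varphi$ into $F$; $\mathrm{Log}\,\mathbf A$ is the set of rules valid in $\mathbf A$. Let $\mathbf{DM}_4$ be the De Morgan algebra on $\{\bot,n,b,\top\}$ with $\bot<n,b<\top$ ($n,b$ incomparable), ${\sim}\top=\bot$, ${\sim}\bot=\top$, ${\sim}n=n$, ${\sim}b=b$. Let $\mathbf{BD}_4=\langle\mathbf{DM}_4,\{b,\top\}\rangle$, $\mathbf{ETL}_4=\langle\mathbf{DM}_4,\{\top\}\rangle$, $\mathbf{LP}_3$ the submatrix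 of $\mathbf{BD}_4$ on $\{\bot,b,\top\}$ (designated $\{b,\top\}$), $\mathbf{B}_2$ the submatrix of $\mathbf{ETL}_4$ on $\{\bot,\top\}$ (designated $\{\top\}$). $\mathsf{BD}=\mathrm{Log}\,\mathbf{BD}_4$, $\mathsf{ETL}=\mathrm{Log}\,\mathbf{ETL}_4$, $\mathsf{LP}=\mathrm{Log}\,\mathbf{LP}_3$, $\mathsf{CL}=\mathrm{Log}\,\mathbf{B}_2$. $\mathsf{ECQ}$ is the extension of $\mathsf{BD}$ by the rule $p,{\sim}p\vdash q$ ($p,q$ distinct variables). -}

module Defs where

open import Level using (Level; Lift; lift; 0ℓ) renaming (suc to lsuc)
open import Data.Nat using (ℕ; zero; suc)
open import Data.Product using (Σ; _×_; _,_; proj₁; proj₂)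
open import Data.Sum using (_⊎_; inj₁; inj₂)
open import Relation.Nullary using (¬_)
open import Relation.Binary.PropositionalEquality using (_≡_; refl; sym; trans; cong; cong₂; subst)

infixr 7 _⋀_
infixr 6 _⋁_
infix 8 ∼_

data Fm : Set where
  var : ℕ → Fm
  _⋀_ : Fm → Fm → Fm
  _⋁_ : Fm → Fm → Fm
  ∼_  : Fm → Fm
  ⊤f  : Fm
  ⊥f  : Fm

Sub : Set
Sub = ℕ → Fm

_[_] : Fm → Sub → Fm
var x [ σ ] = σ x
(φ ⋀ ψ) [ σ ] = (φ [ σ ]) ⋀ (ψ [ σ ])
(φ ⋁ ψ) [ σ ] = (φ [ σ ]) ⋁ (ψ [ σ ])
(∼ φ) [ σ ] = ∼ (φ [ σ ])
⊤f [ σ ] = ⊤f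
⊥f [ σ ] = ⊥f

FmSet : Set₁
FmSet = Fm → Set

_⊆_ : FmSet → FmSet → Set
Γ ⊆ Δ = ∀ φ → Γ φ → Δ φ

_⟦_⟧ : FmSet → Sub → FmSet
Γ ⟦ σ ⟧ = λ ψ → Σ Fm (λ χ → Γ χ × (ψ ≡ χ [ σ ]))

Rules : Set₂
Rules = FmSet → Fm → Set₁

record Logic : Set₂ where
  field
    _⊢_ : FmSet → Fm → Set₁
    reflexivity  : ∀ {Γ φ} → Γ φ → Γ ⊢ φ
    monotonicity : ∀ {Γ Δ φ} → Γ ⊆ Δ → Γ ⊢ φ → Δ ⊢ φ
    cut          : ∀ {Γ Δ φ} → (∀ ψ → Δ ψ → Γ ⊢ ψ) → Δ ⊢ φ → Γ ⊢ φ
    structural   : ∀ {Γ φ} (σ : Sub) → Γ ⊢ φ → (Γ ⟦ σ ⟧) ⊢ (φ [ σ ])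

open Logic public

_≤L_ : Logic → Logic → Set₁
L₁ ≤L L₂ = ∀ Γ φ → _⊢_ L₁ Γ φ → _⊢_ L₂ Γ φ

_≐L_ : Logic → Logic → Set₁
L₁ ≐L L₂ = (L₁ ≤L L₂) × (L₂ ≤L L₁)

_∈[_,_] : Logic → Logic → Logic → Set₁
L ∈[ L₁ , L₂ ] = (L₁ ≤L L) × (L ≤L L₂)

Trivial : Logic
Trivial = record
  { _⊢_ = λ _ _ → Lift (lsuc 0ℓ) Data.Unit.⊤
  ; reflexivity = λ _ → lift Data.Unit.tt
  ; monotonicity = λ _ _ → lift Data.Unit.tt
  ; cut = λ _ _ → lift Data.Unit.tt
  ; structural = λ _ _ → lift Data.Unit.tt
  }
  where import Data.Unit

_∩L_ : Logic → Logic → Logic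
L₁ ∩L L₂ = record
  { _⊢_ = λ Γ φ → _⊢_ L₁ Γ φ × _⊢_ L₂ Γ φ
  ; reflexivity = λ x → reflexivity L₁ x , reflexivity L₂ x
  ; monotonicity = λ s d → monotonicity L₁ s (proj₁ d) , monotonicity L₂ s (proj₂ d)
  ; cut = λ h d → cut L₁ (λ ψ x → proj₁ (h ψ x)) (proj₁ d) , cut L₂ (λ ψ x → proj₂ (h ψ x)) (proj₂ d)
  ; structural = λ σ d → structural L₁ σ (proj₁ d) , structural L₂ σ (proj₂ d)
  }

data Cl (R : Rules) : FmSet → Fm → Set₁ where
  base  : ∀ {Γ φ} → R Γ φ → Cl R Γ φ
  refl' : ∀ {Γ φ} → Γ φ → Cl R Γ φ
  mono  : ∀ {Γ Δ φ} → Γ ⊆ Δ → Cl R Γ φ → Cl R Δ φ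
  cut'  : ∀ {Γ Δ φ} → (∀ ψ → Δ ψ → Cl R Γ ψ) → Cl R Δ φ → Cl R Γ φ
  sub'  : ∀ {Γ φ} (σ : Sub) → Cl R Γ φ → Cl R (Γ ⟦ σ ⟧) (φ [ σ ])

Least : Rules → Logic
Least R = record
  { _⊢_ = Cl R
  ; reflexivity = refl'
  ; monotonicity = mono
  ; cut = cut'
  ; structural = sub'
  }

_∨L_ : Logic → Logic → Logic
L₁ ∨L L₂ = Least (λ Γ φ → _⊢_ L₁ Γ φ ⊎ _⊢_ L₂ Γ φ)

Ext : Logic → Rules → Logic
Ext L R = Least (λ Γ φ → _⊢_ L Γ φ ⊎ R Γ φ)

record Matrix : Set₁ where
  field
    Carrier : Set
    _∧ᵃ_ : Carrier → Carrier → Carrier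
    _∨ᵃ_ : Carrier → Carrier → Carrier
    ∼ᵃ   : Carrier → Carrier
    ⊤ᵃ   : Carrier
    ⊥ᵃ   : Carrier
    Designated : Carrier → Set

  eval : (ℕ → Carrier) → Fm → Carrier
  eval v (var x) = v x
  eval v (φ ⋀ ψ) = eval v φ ∧ᵃ eval v ψ
  eval v (φ ⋁ ψ) = eval v φ ∨ᵃ eval v ψ
  eval v (∼ φ) = ∼ᵃ (eval v φ)
  eval v ⊤f = ⊤ᵃ
  eval v ⊥f = ⊥ᵃ

  eval-sub : ∀ (v : ℕ → Carrier) σ φ → eval v (φ [ σ ]) ≡ eval (λ x → eval v (σ x)) φ
  eval-sub v σ (var x) = refl
  eval-sub v σ (φ ⋀ ψ) = cong₂ _∧ᵃ_ (eval-sub v σ φ) (eval-sub v σ ψ)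
  eval-sub v σ (φ ⋁ ψ) = cong₂ _∨ᵃ_ (eval-sub v σ φ) (eval-sub v σ ψ)
  eval-sub v σ (∼ φ) = cong ∼ᵃ (eval-sub v σ φ)
  eval-sub v σ ⊤f = refl
  eval-sub v σ ⊥f = refl

  -- validity of a rule: valuations (homomorphisms Fm → A are exactly
  -- the eval v) sending Γ into F send φ into F
  Valid : FmSet → Fm → Set
  Valid Γ φ = ∀ (v : ℕ → Carrier) → (∀ ψ → Γ ψ → Designated (eval v ψ)) → Designated (eval v φ)

Log : Matrix → Logic
Log M = record
  { _⊢_ = λ Γ φ → Lift (lsuc 0ℓ) (Valid Γ φ)
  ; reflexivity = λ {Γ} {φ} x → lift (λ v h → h φ x)
  ; monotonicity = λ s d → lift (λ v h → Level.lower d v (λ ψ x → h ψ (s ψ x)))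
  ; cut = λ h d → lift (λ v g → Level.lower d v (λ ψ x → Level.lower (h ψ x) v g))
  ; structural = λ {Γ} {φ} σ d → lift (λ v g →
      subst Designated (sym (eval-sub v σ φ))
        (Level.lower d (λ x → eval v (σ x))
          (λ ψ x → subst Designated (eval-sub v σ ψ) (g (ψ [ σ ]) (ψ , x , refl)))))
  }
  where open Matrix M

record Closed (M : Matrix) (S : Matrix.Carrier M → Set) : Set where
  open Matrix M
  field
    cl-∧ : ∀ {x y} → S x → S y → S (x ∧ᵃ y)
    cl-∨ : ∀ {x y} → S x → S y → S (x ∨ᵃ y)
    cl-∼ : ∀ {x} → S x → S (∼ᵃ x)
    cl-⊤ : S ⊤ᵃ
    cl-⊥ : S ⊥ᵃ

Submatrix : (M : Matrix) (S : Matrix.Carrier M → Set) → Closed M S → Matrix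
Submatrix M S c = record
  { Carrier = Σ Carrier S
  ; _∧ᵃ_ = λ x y → (proj₁ x ∧ᵃ proj₁ y) , cl-∧ (proj₂ x) (proj₂ y)
  ; _∨ᵃ_ = λ x y → (proj₁ x ∨ᵃ proj₁ y) , cl-∨ (proj₂ x) (proj₂ y)
  ; ∼ᵃ = λ x → ∼ᵃ (proj₁ x) , cl-∼ (proj₂ x)
  ; ⊤ᵃ = ⊤ᵃ , cl-⊤
  ; ⊥ᵃ = ⊥ᵃ , cl-⊥
  ; Designated = λ x → Designated (proj₁ x)
  }
  where open Matrix M
        open Closed c

-- The De Morgan algebra DM₄ on {⊥, n, b, ⊤}, ⊥ < n, b < ⊤

data V4 : Set where
  ⊥v nv bv ⊤v : V4

_∧4_ : V4 → V4 → V4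
⊥v ∧4 y = ⊥v
⊤v ∧4 y = y
nv ∧4 ⊥v = ⊥v
nv ∧4 nv = nv
nv ∧4 bv = ⊥v
nv ∧4 ⊤v = nv
bv ∧4 ⊥v = ⊥v
bv ∧4 nv = ⊥v
bv ∧4 bv = bv
bv ∧4 ⊤v = bv

_∨4_ : V4 → V4 → V4
⊥v ∨4 y = y
⊤v ∨4 y = ⊤v
nv ∨4 ⊥v = nv
nv ∨4 nv = nv
nv ∨4 bv = ⊤v
nv ∨4 ⊤v = ⊤v
bv ∨4 ⊥v = bv
bv ∨4 nv = ⊤v
bv ∨4 bv = bv
bv ∨4 ⊤v = ⊤v

∼4 : V4 → V4
∼4 ⊥v = ⊤v
∼4 nv = nv
∼4 bv = bv
∼4 ⊤v = ⊥v

DM4-matrix : (V4 → Set) → Matrix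
DM4-matrix F = record
  { Carrier = V4 ; _∧ᵃ_ = _∧4_ ; _∨ᵃ_ = _∨4_ ; ∼ᵃ = ∼4 ; ⊤ᵃ = ⊤v ; ⊥ᵃ = ⊥v
  ; Designated = F }

BD4 : Matrix
BD4 = DM4-matrix (λ x → (x ≡ bv) ⊎ (x ≡ ⊤v))

ETL4 : Matrix
ETL4 = DM4-matrix (λ x → x ≡ ⊤v)

InLP : V4 → Set
InLP x = (x ≡ ⊥v) ⊎ ((x ≡ bv) ⊎ (x ≡ ⊤v))

LP-closed : Closed BD4 InLP
LP-closed = record
  { cl-∧ = cl∧ ; cl-∨ = cl∨ ; cl-∼ = cl∼ ; cl-⊤ = inj₂ (inj₂ refl) ; cl-⊥ = inj₁ refl }
  where
  cl∧ : ∀ {x y} → InLP x → InLP y → InLP (x ∧4 y)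
  cl∧ (inj₁ refl) _ = inj₁ refl
  cl∧ (inj₂ (inj₂ refl)) h = h
  cl∧ (inj₂ (inj₁ refl)) (inj₁ refl) = inj₁ refl
  cl∧ (inj₂ (inj₁ refl)) (inj₂ (inj₁ refl)) = inj₂ (inj₁ refl)
  cl∧ (inj₂ (inj₁ refl)) (inj₂ (inj₂ refl)) = inj₂ (inj₁ refl)
  cl∨ : ∀ {x y} → InLP x → InLP y → InLP (x ∨4 y)
  cl∨ (inj₁ refl) h = h
  cl∨ (inj₂ (inj₂ refl)) _ = inj₂ (inj₂ refl)
  cl∨ (inj₂ (inj₁ refl)) (inj₁ refl) = inj₂ (inj₁ refl)
  cl∨ (inj₂ (inj₁ refl)) (inj₂ (inj₁ refl)) = inj₂ (inj₁ refl)
  cl∨ (inj₂ (inj₁ refl)) (inj₂ (inj₂ refl)) = inj₂ (inj₂ refl)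
  cl∼ : ∀ {x} → InLP x → InLP (∼4 x)
  cl∼ (inj₁ refl) = inj₂ (inj₂ refl)
  cl∼ (inj₂ (inj₁ refl)) = inj₂ (inj₁ refl)
  cl∼ (inj₂ (inj₂ refl)) = inj₁ refl

LP3 : Matrix
LP3 = Submatrix BD4 InLP LP-closed

InB2 : V4 → Set
InB2 x = (x ≡ ⊥v) ⊎ (x ≡ ⊤v)

B2-closed : Closed ETL4 InB2
B2-closed = record
  { cl-∧ = cl∧ ; cl-∨ = cl∨ ; cl-∼ = cl∼ ; cl-⊤ = inj₂ refl ; cl-⊥ = inj₁ refl }
  where
  cl∧ : ∀ {x y} → InB2 x → InB2 y → InB2 (x ∧4 y)
  cl∧ (inj₁ refl) _ = inj₁ refl
  cl∧ (inj₂ refl) h = h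
  cl∨ : ∀ {x y} → InB2 x → InB2 y → InB2 (x ∨4 y)
  cl∨ (inj₁ refl) h = h
  cl∨ (inj₂ refl) _ = inj₂ refl
  cl∼ : ∀ {x} → InB2 x → InB2 (∼4 x)
  cl∼ (inj₁ refl) = inj₂ refl
  cl∼ (inj₂ refl) = inj₁ refl

B2 : Matrix
B2 = Submatrix ETL4 InB2 B2-closed

BD ETL LP CL : Logic
BD = Log BD4
ETL = Log ETL4
LP = Log LP3
CL = Log B2

-- the single rule  p , ∼p ⊢ q  (p = var 0, q = var 1)
ECQ-rule : Rules
ECQ-rule Γ φ = (Γ ≡ (λ ψ → (ψ ≡ var 0) ⊎ (ψ ≡ ∼ var 0))) × Lift (lsuc 0ℓ) (φ ≡ var 1)

ECQ : Logic
ECQ = Ext BD ECQ-rule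

NonTrivial : Logic → Set₁
NonTrivial L = ¬ (L ≐L Trivial)

ProperExtension : Logic → Logic → Set₁
ProperExtension L₀ L = (L₀ ≤L L) × ¬ (L ≐L L₀)

-- An extension L of BD is located by the three rules it may derive: ECQ (p, ∼p ⊢ q), disjunctive
-- syllogism DS (p, ∼p ∨ q ⊢ q) and Kleene's rule (p, ∼p ⊢ q ∨ ∼q). Such rules are extracted from
-- counter-models by substitution: if u refutes a rule of L in DM₄, replacing each variable x by a formula
-- in p, q that takes the value u x whenever p = b and q = n turns that rule into Kleene's rule over BD;
-- likewise an LP₃-refutation yields ECQ, and an LP₃-refutation glued with a classical model of the
-- premises yields DS. Conversely, Kleene's rule lets an ECQ-contradictory set of premises derive every
-- excluded middle, which reduces BD₄ to LP₃, so LP ∩ ECQ ≤ L; DS gives ETL ≤ L and its failure gives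
-- L ≤ LP ∨ ECQ via compactness of ETL₄ and of B₂; non-triviality alone gives L ≤ CL. The intervals are
-- separated by ECQ, which fails in LP, and DS, which holds in ETL but fails in LP ∨ ECQ.
module Submission where

open import Defs
open import Level using (0ℓ; lift; lower) renaming (suc to lsuc)
open import Axiom.ExcludedMiddle using (ExcludedMiddle)
open import Data.Bool using (Bool; true; false; T)
open import Data.Empty using (⊥; ⊥-elim)
open import Data.List using (List; []; _∷_; foldr; concatMap)
open import Data.List.Membership.Propositional using (_∈_)
open import Data.List.Membership.Propositional.Properties using (∈-concatMap⁺; ∈-concatMap⁻)
open import Data.List.Relation.Unary.Any using (here; there; satisfied)
open import Data.Nat using (ℕ; zero; suc; _<_; _≤_; _≤?_; _⊔_; s≤s; _≟_)
open import Data.Nat.Properties using (<-≤-trans; m<n⇒m<n⊔o; m<n⇒m<o⊔n; n<1+n; <⇒≢; m<1+n⇒m<n∨m≡n)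
open import Data.Product using (Σ; ∃; _×_; _,_; proj₁; proj₂)
open import Data.Sum using (_⊎_; inj₁; inj₂; [_,_]′) renaming (map to ⊎-map)
open import Data.Unit using (⊤; tt)
open import Function using (_∘_; id; _⇔_; mk⇔; Equivalence)
open import Function.Properties.Equivalence using () renaming (trans to ⇔-trans)
open import Relation.Binary.Definitions using (DecidableEquality)
open import Relation.Binary.PropositionalEquality using (_≡_; _≢_; refl; sym; trans; cong; cong₂; subst)
open import Relation.Nullary using (¬_; Dec; yes; no)
open import Relation.Nullary.Decidable
  using (from-yes; map′; T?; ¬?; _×-dec_; _⊎-dec_; _→-dec_; decidable-stable)

open Equivalence using (to; from)

private variable
  a b c d x y : V4
  u w : ℕ → V4
  σ : Sub
  φ ψ χ : Fm
  Γ Δ : FmSet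
  S F : V4 → Set
  L X Y : Logic
  R : Rules

infix 4 _≟₄_ _⊑_ _⊑?_

_≟₄_ : DecidableEquality V4
⊥v ≟₄ ⊥v = yes refl
⊥v ≟₄ nv = no λ ()
⊥v ≟₄ bv = no λ ()
⊥v ≟₄ ⊤v = no λ ()
nv ≟₄ ⊥v = no λ ()
nv ≟₄ nv = yes refl
nv ≟₄ bv = no λ ()
nv ≟₄ ⊤v = no λ ()
bv ≟₄ ⊥v = no λ ()
bv ≟₄ nv = no λ ()
bv ≟₄ bv = yes refl
bv ≟₄ ⊤v = no λ ()
⊤v ≟₄ ⊥v = no λ ()
⊤v ≟₄ nv = no λ ()
⊤v ≟₄ bv = no λ ()
⊤v ≟₄ ⊤v = yes refl

-- Statements quantifying over DM₄ are proved below as  from-yes (∀₄? …),  which type-checks exactly when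
-- the decision procedure, run on all values, says yes.
∀₄? : {P : V4 → Set} → (∀ a → Dec (P a)) → Dec (∀ a → P a)
∀₄? P? = map′ (λ { (p⊥ , pn , pb , p⊤) → λ { ⊥v → p⊥ ; nv → pn ; bv → pb ; ⊤v → p⊤ } })
              (λ h → h ⊥v , h nv , h bv , h ⊤v)
              (P? ⊥v ×-dec P? nv ×-dec P? bv ×-dec P? ⊤v)

Des : V4 → Set
Des x = (x ≡ bv) ⊎ (x ≡ ⊤v)

Des? : ∀ x → Dec (Des x)
Des? x = x ≟₄ bv ⊎-dec x ≟₄ ⊤v

InLP? : ∀ x → Dec (InLP x)
InLP? x = x ≟₄ ⊥v ⊎-dec x ≟₄ bv ⊎-dec x ≟₄ ⊤v

InB2? : ∀ x → Dec (InB2 x)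
InB2? x = x ≟₄ ⊥v ⊎-dec x ≟₄ ⊤v

-- The knowledge order: n is least, b is greatest, ⊥ and ⊤ lie in between.
_⊑ᵇ_ : V4 → V4 → Bool
nv ⊑ᵇ _  = true
_  ⊑ᵇ bv = true
⊥v ⊑ᵇ ⊥v = true
⊤v ⊑ᵇ ⊤v = true
_  ⊑ᵇ _  = false

_⊑_ : V4 → V4 → Set
a ⊑ b = T (a ⊑ᵇ b)

_⊑?_ : ∀ a b → Dec (a ⊑ b)
a ⊑? b = T? (a ⊑ᵇ b)

∧-mono-⊑ : a ⊑ b → c ⊑ d → a ∧4 c ⊑ b ∧4 d
∧-mono-⊑ {a} {b} {c} {d} = from-yes (∀₄? λ a → ∀₄? λ b → ∀₄? λ c → ∀₄? λ d →
  a ⊑? b →-dec c ⊑? d →-dec (a ∧4 c) ⊑? (b ∧4 d)) a b c d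

∨-mono-⊑ : a ⊑ b → c ⊑ d → a ∨4 c ⊑ b ∨4 d
∨-mono-⊑ {a} {b} {c} {d} = from-yes (∀₄? λ a → ∀₄? λ b → ∀₄? λ c → ∀₄? λ d →
  a ⊑? b →-dec c ⊑? d →-dec (a ∨4 c) ⊑? (b ∨4 d)) a b c d

∼-mono-⊑ : a ⊑ b → ∼4 a ⊑ ∼4 b
∼-mono-⊑ {a} {b} = from-yes (∀₄? λ a → ∀₄? λ b → a ⊑? b →-dec ∼4 a ⊑? ∼4 b) a b

Des-⊑ : a ⊑ b → Des a → Des b
Des-⊑ {a} {b} = from-yes (∀₄? λ a → ∀₄? λ b → a ⊑? b →-dec Des? a →-dec Des? b) a b

¬Des-⊥ : ¬ Des ⊥v
¬Des-⊥ (inj₁ ())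
¬Des-⊥ (inj₂ ())

Des-∧ : Des a → Des b → Des (a ∧4 b)
Des-∧ {a} {b} = from-yes (∀₄? λ a → ∀₄? λ b → Des? a →-dec Des? b →-dec Des? (a ∧4 b)) a b

∧-⊤ : a ∧4 b ≡ ⊤v → a ≡ ⊤v × b ≡ ⊤v
∧-⊤ {a} {b} = from-yes (∀₄? λ a → ∀₄? λ b → a ∧4 b ≟₄ ⊤v →-dec a ≟₄ ⊤v ×-dec b ≟₄ ⊤v) a b

Des-∼Des⇒b : Des a → Des (∼4 a) → a ≡ bv
Des-∼Des⇒b {a} = from-yes (∀₄? λ a → Des? a →-dec Des? (∼4 a) →-dec a ≟₄ bv) a

excluded-middle-or-n : ∀ a → Des (a ∨4 ∼4 a) ⊎ a ≡ nv
excluded-middle-or-n = from-yes (∀₄? λ a → Des? (a ∨4 ∼4 a) ⊎-dec a ≟₄ nv)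

excluded-middle⇒InLP : Des (a ∨4 ∼4 a) → InLP a
excluded-middle⇒InLP {a} = from-yes (∀₄? λ a → Des? (a ∨4 ∼4 a) →-dec InLP? a) a

DS-premises-cases : Des a → Des (∼4 a ∨4 b) → a ≡ bv ⊎ (a ≡ ⊤v × Des b)
DS-premises-cases {a} {b} = from-yes (∀₄? λ a → ∀₄? λ b →
  Des? a →-dec Des? (∼4 a ∨4 b) →-dec (a ≟₄ bv ⊎-dec (a ≟₄ ⊤v ×-dec Des? b))) a b

b⇒Des-∼∨ : a ≡ bv → Des (∼4 a ∨4 b)
b⇒Des-∼∨ {a} {b} = from-yes (∀₄? λ a → ∀₄? λ b → a ≟₄ bv →-dec Des? (∼4 a ∨4 b)) a b

⊤⇒Des-∨ : b ≡ ⊤v → Des (a ∨4 b)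
⊤⇒Des-∨ {b} {a} = from-yes (∀₄? λ b → ∀₄? λ a → b ≟₄ ⊤v →-dec Des? (a ∨4 b)) b a

B2-consistent : InB2 a → ¬ (Des a × Des (∼4 a))
B2-consistent {a} = from-yes (∀₄? λ a → InB2? a →-dec ¬? (Des? a ×-dec Des? (∼4 a))) a

B2-⊑⊤ : InB2 a → a ⊑ ⊤v → a ≡ ⊤v
B2-⊑⊤ {a} = from-yes (∀₄? λ a → InB2? a →-dec a ⊑? ⊤v →-dec a ≟₄ ⊤v) a

collapse : V4 → V4
collapse bv = ⊤v
collapse a  = a

collapse-⊑ : ∀ a → collapse a ⊑ a
collapse-⊑ = from-yes (∀₄? λ a → collapse a ⊑? a)

collapse-B2 : InLP a → InB2 (collapse a)
collapse-B2 {a} = from-yes (∀₄? λ a → InLP? a →-dec InB2? (collapse a)) a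

ev : (ℕ → V4) → Fm → V4
ev = Matrix.eval BD4

ev-mono : (∀ x → u x ⊑ w x) → ∀ φ → ev u φ ⊑ ev w φ
ev-mono h (var x) = h x
ev-mono h (φ ⋀ ψ) = ∧-mono-⊑ (ev-mono h φ) (ev-mono h ψ)
ev-mono h (φ ⋁ ψ) = ∨-mono-⊑ (ev-mono h φ) (ev-mono h ψ)
ev-mono h (∼ φ) = ∼-mono-⊑ (ev-mono h φ)
ev-mono h ⊤f = tt
ev-mono h ⊥f = tt

ev-B2 : (∀ x → InB2 (u x)) → ∀ φ → InB2 (ev u φ)
ev-B2 h (var x) = h x
ev-B2 h (φ ⋀ ψ) = Closed.cl-∧ B2-closed (ev-B2 h φ) (ev-B2 h ψ)
ev-B2 h (φ ⋁ ψ) = Closed.cl-∨ B2-closed (ev-B2 h φ) (ev-B2 h ψ)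
ev-B2 h (∼ φ) = Closed.cl-∼ B2-closed (ev-B2 h φ)
ev-B2 h ⊤f = Closed.cl-⊤ B2-closed
ev-B2 h ⊥f = Closed.cl-⊥ B2-closed

ev-[]-≡ : (∀ x → ev w (σ x) ≡ u x) → ∀ φ → ev w (φ [ σ ]) ≡ ev u φ
ev-[]-≡ h (var x) = h x
ev-[]-≡ h (φ ⋀ ψ) = cong₂ _∧4_ (ev-[]-≡ h φ) (ev-[]-≡ h ψ)
ev-[]-≡ h (φ ⋁ ψ) = cong₂ _∨4_ (ev-[]-≡ h φ) (ev-[]-≡ h ψ)
ev-[]-≡ h (∼ φ) = cong ∼4 (ev-[]-≡ h φ)
ev-[]-≡ h ⊤f = refl
ev-[]-≡ h ⊥f = refl

ev-[]-⊑ : (∀ x → u x ⊑ ev w (σ x)) → ∀ φ → ev u φ ⊑ ev w (φ [ σ ])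
ev-[]-⊑ h (var x) = h x
ev-[]-⊑ h (φ ⋀ ψ) = ∧-mono-⊑ (ev-[]-⊑ h φ) (ev-[]-⊑ h ψ)
ev-[]-⊑ h (φ ⋁ ψ) = ∨-mono-⊑ (ev-[]-⊑ h φ) (ev-[]-⊑ h ψ)
ev-[]-⊑ h (∼ φ) = ∼-mono-⊑ (ev-[]-⊑ h φ)
ev-[]-⊑ h ⊤f = tt
ev-[]-⊑ h ⊥f = tt

bound : Fm → ℕ
bound (var x) = suc x
bound (φ ⋀ ψ) = bound φ ⊔ bound ψ
bound (φ ⋁ ψ) = bound φ ⊔ bound ψ
bound (∼ φ) = bound φ
bound ⊤f = zero
bound ⊥f = zero

ev-cong : ∀ φ → (∀ x → x < bound φ → u x ≡ w x) → ev u φ ≡ ev w φ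
ev-cong (var x) h = h x (n<1+n x)
ev-cong (φ ⋀ ψ) h = cong₂ _∧4_ (ev-cong φ λ x → h x ∘ m<n⇒m<n⊔o (bound ψ)) (ev-cong ψ λ x → h x ∘ m<n⇒m<o⊔n (bound φ))
ev-cong (φ ⋁ ψ) h = cong₂ _∨4_ (ev-cong φ λ x → h x ∘ m<n⇒m<n⊔o (bound ψ)) (ev-cong ψ λ x → h x ∘ m<n⇒m<o⊔n (bound φ))
ev-cong (∼ φ) h = cong ∼4 (ev-cong φ h)
ev-cong ⊤f h = refl
ev-cong ⊥f h = refl

val₂ : V4 → V4 → ℕ → V4
val₂ x y zero = x
val₂ x y (suc _) = y

val₂-preserves : S x → S y → ∀ n → S (val₂ x y n)
val₂-preserves Sx Sy zero = Sx
val₂-preserves Sx Sy (suc _) = Sy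

ev-val₂ : ∀ φ → bound φ ≤ 2 → ev w φ ≡ ev (val₂ (w 0) (w 1)) φ
ev-val₂ {w} φ φ≤2 = ev-cong φ agree
  where
  agree : ∀ x → x < bound φ → w x ≡ val₂ (w 0) (w 1) x
  agree 0 _ = refl
  agree 1 _ = refl
  agree (suc (suc x)) x<φ with <-≤-trans x<φ φ≤2
  ... | s≤s (s≤s ())

p q : Fm
p = var 0
q = var 1

⌜_⌝ : V4 → Fm
⌜ ⊥v ⌝ = ⊥f
⌜ nv ⌝ = q
⌜ bv ⌝ = p
⌜ ⊤v ⌝ = ⊤f

⌜_⌝ˢ : (ℕ → V4) → Sub
⌜ u ⌝ˢ x = ⌜ u x ⌝

⌜⌝-B2 : InB2 a → ev w ⌜ a ⌝ ≡ a
⌜⌝-B2 (inj₁ refl) = refl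
⌜⌝-B2 (inj₂ refl) = refl

⌜⌝-LP : w 0 ≡ bv → InLP a → ev w ⌜ a ⌝ ≡ a
⌜⌝-LP w0≡b (inj₁ refl) = refl
⌜⌝-LP w0≡b (inj₂ (inj₁ refl)) = w0≡b
⌜⌝-LP w0≡b (inj₂ (inj₂ refl)) = refl

⌜⌝-exact : w 0 ≡ bv → w 1 ≡ nv → ∀ a → ev w ⌜ a ⌝ ≡ a
⌜⌝-exact w0≡b w1≡n ⊥v = refl
⌜⌝-exact w0≡b w1≡n nv = w1≡n
⌜⌝-exact w0≡b w1≡n bv = w0≡b
⌜⌝-exact w0≡b w1≡n ⊤v = refl

⌜⌝-⊑ : w 0 ≡ bv → ∀ a → a ⊑ ev w ⌜ a ⌝
⌜⌝-⊑ w0≡b ⊥v = tt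
⌜⌝-⊑ w0≡b nv = tt
⌜⌝-⊑ w0≡b bv = subst (bv ⊑_) (sym w0≡b) tt
⌜⌝-⊑ w0≡b ⊤v = tt

-- For a ∈ LP₃ and c ∈ B₂: a formula in p, q that behaves like a when p = b,
-- and like c when p = ⊤ and q is designated.
⌜_∣_⌝ : V4 → V4 → Fm
⌜ ⊤v ∣ ⊤v ⌝ = ⊤f
⌜ ⊥v ∣ ⊥v ⌝ = ⊥f
⌜ bv ∣ ⊤v ⌝ = p
⌜ bv ∣ ⊥v ⌝ = ∼ p
⌜ ⊥v ∣ ⊤v ⌝ = q ⋀ p
⌜ ⊤v ∣ ⊥v ⌝ = ∼ q ⋁ ∼ p
⌜ _  ∣ _  ⌝ = ⊥f

⌜∣⌝-bound : ∀ a c → bound ⌜ a ∣ c ⌝ ≤ 2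
⌜∣⌝-bound = from-yes (∀₄? λ a → ∀₄? λ c → bound ⌜ a ∣ c ⌝ ≤? 2)

⌜∣⌝-⊒-LP : InLP a → InB2 c → x ≡ bv → a ⊑ ev (val₂ x y) ⌜ a ∣ c ⌝
⌜∣⌝-⊒-LP {a} {c} {x} {y} = from-yes (∀₄? λ a → ∀₄? λ c → ∀₄? λ x → ∀₄? λ y →
  InLP? a →-dec InB2? c →-dec x ≟₄ bv →-dec a ⊑? ev (val₂ x y) ⌜ a ∣ c ⌝) a c x y

⌜∣⌝-exact : InLP a → InB2 c → x ≡ bv → ¬ Des y → ev (val₂ x y) ⌜ a ∣ c ⌝ ≡ a
⌜∣⌝-exact {a} {c} {x} {y} = from-yes (∀₄? λ a → ∀₄? λ c → ∀₄? λ x → ∀₄? λ y →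
  InLP? a →-dec InB2? c →-dec x ≟₄ bv →-dec ¬? (Des? y) →-dec ev (val₂ x y) ⌜ a ∣ c ⌝ ≟₄ a) a c x y

⌜∣⌝-⊒-B2 : InLP a → InB2 c → x ≡ ⊤v → Des y → c ⊑ ev (val₂ x y) ⌜ a ∣ c ⌝
⌜∣⌝-⊒-B2 {a} {c} {x} {y} = from-yes (∀₄? λ a → ∀₄? λ c → ∀₄? λ x → ∀₄? λ y →
  InLP? a →-dec InB2? c →-dec x ≟₄ ⊤v →-dec Des? y →-dec c ⊑? ev (val₂ x y) ⌜ a ∣ c ⌝) a c x y

infix 4 _⊢[_]_
infixr 6 _∪_

_⊢[_]_ : FmSet → Logic → Fm → Set₁
Γ ⊢[ L ] φ = _⊢_ L Γ φ

∅ : FmSet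
∅ _ = ⊥

｛_｝ : Fm → FmSet
｛ φ ｝ ψ = ψ ≡ φ

_∪_ : FmSet → FmSet → FmSet
(Γ ∪ Δ) ψ = Γ ψ ⊎ Δ ψ

ECQ-premises DS-premises : FmSet
ECQ-premises = ｛ p ｝ ∪ ｛ ∼ p ｝
DS-premises  = ｛ p ｝ ∪ ｛ ∼ p ⋁ q ｝

Least-≤ : ∀ L → (∀ {Γ φ} → R Γ φ → Γ ⊢[ L ] φ) → Least R ≤L L
Least-≤ {R} L h _ _ = go
  where
  go : Cl R Γ φ → Γ ⊢[ L ] φ
  go (base r) = h r
  go (refl' x) = reflexivity L x
  go (mono Γ⊆Δ d) = monotonicity L Γ⊆Δ (go d)
  go (cut' ds d) = cut L (λ ψ x → go (ds ψ x)) (go d)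
  go (sub' σ d) = structural L σ (go d)

cut-∪ : ∀ L → (∀ ψ → Δ ψ → Γ ⊢[ L ] ψ) → Γ ∪ Δ ⊢[ L ] φ → Γ ⊢[ L ] φ
cut-∪ L ds = cut L λ { ψ (inj₁ x) → reflexivity L x ; ψ (inj₂ x) → ds ψ x }

instantiate : ∀ L σ → Δ ⊢[ L ] φ → (∀ χ → Δ χ → Γ ⊢[ L ] χ [ σ ]) → Γ ⊢[ L ] φ [ σ ]
instantiate L σ d ds = cut L (λ { _ (χ , x , refl) → ds χ x }) (structural L σ d)

pq≔ : Fm → Fm → Sub
pq≔ α β zero = α
pq≔ α β (suc _) = β

apply₂ : ∀ L {ψ₁ ψ₂} α β → ｛ ψ₁ ｝ ∪ ｛ ψ₂ ｝ ⊢[ L ] χ →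
         Γ ⊢[ L ] ψ₁ [ pq≔ α β ] → Γ ⊢[ L ] ψ₂ [ pq≔ α β ] → Γ ⊢[ L ] χ [ pq≔ α β ]
apply₂ L α β rule d₁ d₂ = instantiate L (pq≔ α β) rule λ { _ (inj₁ refl) → d₁ ; _ (inj₂ refl) → d₂ }

∅⊢q⇒trivial : ∀ L → ∅ ⊢[ L ] q → L ≐L Trivial
∅⊢q⇒trivial L d = (λ _ _ _ → lift tt) , λ Γ φ _ → monotonicity L (λ { _ (_ , () , _) }) (structural L (λ _ → φ) d)

Contradictory : Logic → FmSet → Set₁
Contradictory L Γ = Σ Fm λ α → Γ ⊢[ L ] α × Γ ⊢[ L ] ∼ α

contradictory-cut : ∀ L → (∀ ψ → Δ ψ → Γ ⊢[ L ] ψ) → Contradictory L Δ → Contradictory L Γ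
contradictory-cut L ds (α , ⊢α , ⊢∼α) = α , cut L ds ⊢α , cut L ds ⊢∼α

contradictory-sub : ∀ L σ → Contradictory L Γ → Contradictory L (Γ ⟦ σ ⟧)
contradictory-sub L σ (α , ⊢α , ⊢∼α) = α [ σ ] , structural L σ ⊢α , structural L σ ⊢∼α

contradictory-≤ : X ≤L Y → Contradictory X Γ → Contradictory Y Γ
contradictory-≤ X≤Y (α , ⊢α , ⊢∼α) = α , X≤Y _ _ ⊢α , X≤Y _ _ ⊢∼α

explode : ∀ L → ECQ-premises ⊢[ L ] q → Contradictory L Γ → Γ ⊢[ L ] φ
explode {φ = φ} L ecq (α , ⊢α , ⊢∼α) = apply₂ L α φ ecq ⊢α ⊢∼α

LP≤LP∨ECQ : LP ≤L (LP ∨L ECQ)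
LP≤LP∨ECQ _ _ = base ∘ inj₁

ECQ∈ECQ : ECQ-premises ⊢[ ECQ ] q
ECQ∈ECQ = base (inj₂ (refl , lift refl))

Valid-on : (M : Matrix) → (Matrix.Carrier M → Set) → FmSet → Fm → Set
Valid-on M S Γ φ = ∀ u → (∀ x → S (u x)) → (∀ ψ → Γ ψ → Designated (eval u ψ)) → Designated (eval u φ)
  where open Matrix M

Entails : (S F : V4 → Set) → FmSet → Fm → Set
Entails S F Γ φ = ∀ u → (∀ x → S (u x)) → (∀ ψ → Γ ψ → F (ev u ψ)) → F (ev u φ)

Model : (S F : V4 → Set) → (ℕ → V4) → FmSet → Set
Model S F u Γ = (∀ x → S (u x)) × (∀ ψ → Γ ψ → F (ev u ψ))

Refutes : (S F : V4 → Set) → (ℕ → V4) → FmSet → Fm → Set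
Refutes S F u Γ φ = Model S F u Γ × ¬ F (ev u φ)

infix 4 _⊨BD_ _⊨LP_ _⊨ETL_ _⊨CL_

_⊨BD_ _⊨LP_ _⊨ETL_ _⊨CL_ : FmSet → Fm → Set
_⊨BD_  = Entails (λ _ → ⊤) Des
_⊨LP_  = Entails InLP Des
_⊨ETL_ = Entails (λ _ → ⊤) (_≡ ⊤v)
_⊨CL_  = Entails InB2 (_≡ ⊤v)

eval-Submatrix : ∀ M S (c : Closed M S) v φ →
                 proj₁ (Matrix.eval (Submatrix M S c) v φ) ≡ Matrix.eval M (proj₁ ∘ v) φ
eval-Submatrix M S c v (var x) = refl
eval-Submatrix M S c v (φ ⋀ ψ) = cong₂ (Matrix._∧ᵃ_ M) (eval-Submatrix M S c v φ) (eval-Submatrix M S c v ψ)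
eval-Submatrix M S c v (φ ⋁ ψ) = cong₂ (Matrix._∨ᵃ_ M) (eval-Submatrix M S c v φ) (eval-Submatrix M S c v ψ)
eval-Submatrix M S c v (∼ φ) = cong (Matrix.∼ᵃ M) (eval-Submatrix M S c v φ)
eval-Submatrix M S c v ⊤f = refl
eval-Submatrix M S c v ⊥f = refl

eval-DM4 : ∀ F u φ → Matrix.eval (DM4-matrix F) u φ ≡ ev u φ
eval-DM4 F u (var x) = refl
eval-DM4 F u (φ ⋀ ψ) = cong₂ _∧4_ (eval-DM4 F u φ) (eval-DM4 F u ψ)
eval-DM4 F u (φ ⋁ ψ) = cong₂ _∨4_ (eval-DM4 F u φ) (eval-DM4 F u ψ)
eval-DM4 F u (∼ φ) = cong ∼4 (eval-DM4 F u φ)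
eval-DM4 F u ⊤f = refl
eval-DM4 F u ⊥f = refl

Log⇔Valid-on : ∀ M → Γ ⊢[ Log M ] φ ⇔ Valid-on M (λ _ → ⊤) Γ φ
Log⇔Valid-on M = mk⇔ (λ d u _ → lower d u) (λ h → lift λ u → h u (λ _ → tt))

Log-Submatrix⇔Valid-on : ∀ M S (c : Closed M S) → Γ ⊢[ Log (Submatrix M S c) ] φ ⇔ Valid-on M S Γ φ
Log-Submatrix⇔Valid-on {φ = φ} M S c = mk⇔
  (λ d u Su sat → subst D (eval-Submatrix M S c (λ x → u x , Su x) φ)
                    (lower d (λ x → u x , Su x) λ ψ x → subst D (sym (eval-Submatrix M S c _ ψ)) (sat ψ x)))
  (λ h → lift λ v sat → subst D (sym (eval-Submatrix M S c v φ))
                          (h (proj₁ ∘ v) (proj₂ ∘ v) λ ψ x → subst D (eval-Submatrix M S c v ψ) (sat ψ x)))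
  where D = Matrix.Designated M

Valid-on-DM4⇔Entails : Valid-on (DM4-matrix F) S Γ φ ⇔ Entails S F Γ φ
Valid-on-DM4⇔Entails {F} {φ = φ} = mk⇔
  (λ h u Su sat → subst F (eval-DM4 F u φ) (h u Su λ ψ x → subst F (sym (eval-DM4 F u ψ)) (sat ψ x)))
  (λ h u Su sat → subst F (sym (eval-DM4 F u φ)) (h u Su λ ψ x → subst F (eval-DM4 F u ψ) (sat ψ x)))

BD⇔⊨ : Γ ⊢[ BD ] φ ⇔ Γ ⊨BD φ
BD⇔⊨ {Γ} {φ} = Log⇔Valid-on {Γ} {φ} BD4

LP⇔⊨ : Γ ⊢[ LP ] φ ⇔ Γ ⊨LP φ
LP⇔⊨ {Γ} {φ} = Log-Submatrix⇔Valid-on {Γ} {φ} BD4 InLP LP-closed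

ETL⇔⊨ : Γ ⊢[ ETL ] φ ⇔ Γ ⊨ETL φ
ETL⇔⊨ {Γ} {φ} = ⇔-trans (Log⇔Valid-on {Γ} {φ} ETL4) (Valid-on-DM4⇔Entails {_≡ ⊤v} {λ _ → ⊤} {Γ} {φ})

CL⇔⊨ : Γ ⊢[ CL ] φ ⇔ Γ ⊨CL φ
CL⇔⊨ {Γ} {φ} = ⇔-trans (Log-Submatrix⇔Valid-on {Γ} {φ} ETL4 InB2 B2-closed)
                        (Valid-on-DM4⇔Entails {_≡ ⊤v} {InB2} {Γ} {φ})

BD≤LP : BD ≤L LP
BD≤LP Γ φ ⊢φ = from (LP⇔⊨ {Γ} {φ}) λ u _ → to (BD⇔⊨ {Γ} {φ}) ⊢φ u (λ _ → tt)

DS∈ETL : DS-premises ⊢[ ETL ] q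
DS∈ETL = from (ETL⇔⊨ {DS-premises} {q}) λ u _ sat →
  subst (λ z → ∼4 z ∨4 u 1 ≡ ⊤v) (sat p (inj₁ refl)) (sat _ (inj₂ refl))

val₂-b⊥-refutes-q : (∀ ψ → Γ ψ → Des (ev (val₂ bv ⊥v) ψ)) → ¬ (Γ ⊢[ LP ] q)
val₂-b⊥-refutes-q {Γ} sat ⊢q = ¬Des-⊥ (to (LP⇔⊨ {Γ} {q}) ⊢q (val₂ bv ⊥v) b⊥-LP sat)
  where b⊥-LP = val₂-preserves {S = InLP} (inj₂ (inj₁ refl)) (inj₁ refl)

ECQ∉LP : ¬ (ECQ-premises ⊢[ LP ] q)
ECQ∉LP = val₂-b⊥-refutes-q λ { _ (inj₁ refl) → inj₁ refl ; _ (inj₂ refl) → inj₁ refl }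

DS∉LP : ¬ (DS-premises ⊢[ LP ] q)
DS∉LP = val₂-b⊥-refutes-q λ { _ (inj₁ refl) → inj₁ refl ; _ (inj₂ refl) → inj₁ refl }

ECQ-premises⇒p≡b : (∀ ψ → ECQ-premises ψ → Des (ev w ψ)) → w 0 ≡ bv
ECQ-premises⇒p≡b sat = Des-∼Des⇒b (sat p (inj₁ refl)) (sat (∼ p) (inj₂ refl))

Excluded-middle : FmSet
Excluded-middle ψ = Σ Fm λ β → ψ ≡ β ⋁ ∼ β

⊨LP⇒⊨BD-with-excluded-middle : Γ ⊨LP φ → Γ ∪ Excluded-middle ⊨BD φ
⊨LP⇒⊨BD-with-excluded-middle Γ⊨φ u _ sat =
  Γ⊨φ u (λ x → excluded-middle⇒InLP (sat _ (inj₂ (var x , refl)))) (λ ψ → sat ψ ∘ inj₁)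

conj : List Fm → Fm
conj = foldr _⋀_ ⊤f

Des-conj : ∀ Γ₀ → (∀ ψ → ψ ∈ Γ₀ → Des (ev u ψ)) → Des (ev u (conj Γ₀))
Des-conj [] _ = inj₂ refl
Des-conj (ψ ∷ Γ₀) sat = Des-∧ (sat ψ (here refl)) (Des-conj Γ₀ λ χ → sat χ ∘ there)

conj-⊤ : ∀ Γ₀ → ev u (conj Γ₀) ≡ ⊤v → ∀ ψ → ψ ∈ Γ₀ → ev u ψ ≡ ⊤v
conj-⊤ (χ ∷ Γ₀) ≡⊤ ψ (here refl) = proj₁ (∧-⊤ ≡⊤)
conj-⊤ (χ ∷ Γ₀) ≡⊤ ψ (there m) = conj-⊤ Γ₀ (proj₂ (∧-⊤ ≡⊤)) ψ m

⊨conj : ∀ {Γ₀} → (_∈ Γ₀) ⊆ Γ → Entails S Des Γ (conj Γ₀)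
⊨conj {Γ₀ = Γ₀} Γ₀⊆Γ u _ sat = Des-conj Γ₀ λ ψ → sat ψ ∘ Γ₀⊆Γ ψ

⊨ETL⇒⊨∼conj∨ : ∀ {Γ₀} → (_∈ Γ₀) ⊆ Γ → (_∈ Γ₀) ⊨ETL φ → Γ ⊨BD ∼ conj Γ₀ ⋁ φ
⊨ETL⇒⊨∼conj∨ {Γ₀ = Γ₀} Γ₀⊆Γ Γ₀⊨φ u _ sat with Des-conj Γ₀ (λ ψ → sat ψ ∘ Γ₀⊆Γ ψ)
... | inj₁ conj≡b = b⇒Des-∼∨ conj≡b
... | inj₂ conj≡⊤ = ⊤⇒Des-∨ (Γ₀⊨φ u _ (conj-⊤ Γ₀ conj≡⊤))

-- Collapsing b to ⊤ turns an LP₃-valuation in which conj Γ₀ is ⊤ into a classical model of Γ₀.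
CL-unsatisfiable⇒LP-contradictory : ∀ {Γ₀} → (_∈ Γ₀) ⊆ Γ → (_∈ Γ₀) ⊨CL ⊥f → Contradictory LP Γ
CL-unsatisfiable⇒LP-contradictory {Γ} {Γ₀} Γ₀⊆Γ Γ₀⊨⊥ =
  conj Γ₀ , from (LP⇔⊨ {Γ} {conj Γ₀}) (⊨conj {S = InLP} Γ₀⊆Γ) , from (LP⇔⊨ {Γ} {∼ conj Γ₀}) ⊨∼conj
  where
  ⊨∼conj : Γ ⊨LP ∼ conj Γ₀
  ⊨∼conj u u-LP sat with Des-conj Γ₀ (λ ψ → sat ψ ∘ Γ₀⊆Γ ψ)
  ... | inj₁ conj≡b = inj₁ (cong ∼4 conj≡b)
  ... | inj₂ conj≡⊤ with Γ₀⊨⊥ (collapse ∘ u) (λ x → collapse-B2 (u-LP x)) collapsed-⊤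
    where
    collapsed-⊤ : ∀ ψ → ψ ∈ Γ₀ → ev (collapse ∘ u) ψ ≡ ⊤v
    collapsed-⊤ ψ m = B2-⊑⊤ (ev-B2 (λ x → collapse-B2 (u-LP x)) ψ)
                            (subst (ev (collapse ∘ u) ψ ⊑_) (conj-⊤ Γ₀ conj≡⊤ ψ m)
                                   (ev-mono (λ x → collapse-⊑ (u x)) ψ))
  ... | ()

module _ (L : Logic) (BD≤L : BD ≤L L) where

  by-BD : Γ ⊨BD φ → Γ ⊢[ L ] φ
  by-BD {Γ} {φ} h = BD≤L Γ φ (from (BD⇔⊨ {Γ} {φ}) h)

  derive-instance : Γ ⊢[ L ] φ → ∀ σ → (∀ χ → Γ χ → Δ ⊨BD χ [ σ ]) → Δ ∪ ｛ φ [ σ ] ｝ ⊨BD ψ → Δ ⊢[ L ] ψ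
  derive-instance ⊢φ σ premises conclusion =
    cut-∪ L (λ { _ refl → instantiate L σ ⊢φ λ χ x → by-BD (premises χ x) }) (by-BD conclusion)

  nontrivial⇒≤CL : NonTrivial L → L ≤L CL
  nontrivial⇒≤CL nontrivial Γ φ ⊢φ = from (CL⇔⊨ {Γ} {φ}) sound
    where
    sound : Γ ⊨CL φ
    sound u u-B2 sat with ev-B2 u-B2 φ
    ... | inj₂ u⊨φ = u⊨φ
    ... | inj₁ u⊭φ = ⊥-elim (nontrivial (∅⊢q⇒trivial L (derive-instance ⊢φ ⌜ u ⌝ˢ premises conclusion)))
      where
      ⌜u⌝-exact : ∀ x → ev w (⌜ u ⌝ˢ x) ≡ u x
      ⌜u⌝-exact x = ⌜⌝-B2 (u-B2 x)
      premises : ∀ χ → Γ χ → ∅ ⊨BD χ [ ⌜ u ⌝ˢ ]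
      premises χ χ∈Γ _ _ _ = inj₂ (trans (ev-[]-≡ ⌜u⌝-exact χ) (sat χ χ∈Γ))
      conclusion : ∅ ∪ ｛ φ [ ⌜ u ⌝ˢ ] ｝ ⊨BD q
      conclusion _ _ sat′ = ⊥-elim (¬Des-⊥ (subst Des (trans (ev-[]-≡ ⌜u⌝-exact φ) u⊭φ) (sat′ _ (inj₂ refl))))

  LP-refutable⇒⊢ECQ : Γ ⊢[ L ] φ → Refutes InLP Des u Γ φ → ECQ-premises ⊢[ L ] q
  LP-refutable⇒⊢ECQ {Γ} {φ} {u} ⊢φ ((u-LP , u-Γ) , u⊭φ) = derive-instance ⊢φ ⌜ u ⌝ˢ premises conclusion
    where
    ⌜u⌝-exact : w 0 ≡ bv → ∀ x → ev w (⌜ u ⌝ˢ x) ≡ u x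
    ⌜u⌝-exact w0≡b x = ⌜⌝-LP w0≡b (u-LP x)
    premises : ∀ χ → Γ χ → ECQ-premises ⊨BD χ [ ⌜ u ⌝ˢ ]
    premises χ χ∈Γ w _ sat = subst Des (sym (ev-[]-≡ (⌜u⌝-exact (ECQ-premises⇒p≡b sat)) χ)) (u-Γ χ χ∈Γ)
    conclusion : ECQ-premises ∪ ｛ φ [ ⌜ u ⌝ˢ ] ｝ ⊨BD q
    conclusion w _ sat = ⊥-elim (u⊭φ (subst Des (ev-[]-≡ (⌜u⌝-exact (ECQ-premises⇒p≡b (λ ψ → sat ψ ∘ inj₁))) φ)
                                                  (sat _ (inj₂ refl))))

  BD-refutable⇒⊢Kleene : Γ ⊢[ L ] φ → Refutes (λ _ → ⊤) Des u Γ φ → ECQ-premises ⊢[ L ] q ⋁ ∼ q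
  BD-refutable⇒⊢Kleene {Γ} {φ} {u} ⊢φ ((_ , u-Γ) , u⊭φ) = derive-instance ⊢φ ⌜ u ⌝ˢ premises conclusion
    where
    premises : ∀ χ → Γ χ → ECQ-premises ⊨BD χ [ ⌜ u ⌝ˢ ]
    premises χ χ∈Γ w _ sat = Des-⊑ (ev-[]-⊑ (λ x → ⌜⌝-⊑ (ECQ-premises⇒p≡b sat) (u x)) χ) (u-Γ χ χ∈Γ)
    conclusion : ECQ-premises ∪ ｛ φ [ ⌜ u ⌝ˢ ] ｝ ⊨BD q ⋁ ∼ q
    conclusion w _ sat with excluded-middle-or-n (w 1)
    ... | inj₁ q∨∼q = q∨∼q
    ... | inj₂ w1≡n = ⊥-elim (u⊭φ (subst Des (ev-[]-≡ (λ x → ⌜⌝-exact w0≡b w1≡n (u x)) φ) (sat _ (inj₂ refl))))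
      where w0≡b = ECQ-premises⇒p≡b (λ ψ → sat ψ ∘ inj₁)

  -- Under the premises of disjunctive syllogism either p = b, and then τ reproduces u unless q is designated,
  -- or p = ⊤ and q is designated, and then τ dominates w.
  LP-refutable+CL-model⇒⊢DS : Γ ⊢[ L ] φ → Refutes InLP Des u Γ φ → Model InB2 (_≡ ⊤v) w Γ → DS-premises ⊢[ L ] q
  LP-refutable+CL-model⇒⊢DS {Γ} {φ} {u} {w} ⊢φ ((u-LP , u-Γ) , u⊭φ) (w-B2 , w-Γ) =
    derive-instance ⊢φ τ premises conclusion
    where
    τ : Sub
    τ x = ⌜ u x ∣ w x ⌝
    τ-val₂ : ∀ w′ x → ev w′ (τ x) ≡ ev (val₂ (w′ 0) (w′ 1)) (τ x)
    τ-val₂ w′ x = ev-val₂ (τ x) (⌜∣⌝-bound (u x) (w x))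
    premises : ∀ χ → Γ χ → DS-premises ⊨BD χ [ τ ]
    premises χ χ∈Γ w′ _ sat with DS-premises-cases (sat p (inj₁ refl)) (sat _ (inj₂ refl))
    ... | inj₁ p≡b = Des-⊑ (ev-[]-⊑ (λ x → subst (u x ⊑_) (sym (τ-val₂ w′ x)) (⌜∣⌝-⊒-LP (u-LP x) (w-B2 x) p≡b)) χ)
                           (u-Γ χ χ∈Γ)
    ... | inj₂ (p≡⊤ , Des-q) =
      Des-⊑ (ev-[]-⊑ (λ x → subst (w x ⊑_) (sym (τ-val₂ w′ x)) (⌜∣⌝-⊒-B2 (u-LP x) (w-B2 x) p≡⊤ Des-q)) χ)
            (inj₂ (w-Γ χ χ∈Γ))
    conclusion : DS-premises ∪ ｛ φ [ τ ] ｝ ⊨BD q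
    conclusion w′ _ sat with Des? (w′ 1) | DS-premises-cases (sat p (inj₁ (inj₁ refl))) (sat _ (inj₁ (inj₂ refl)))
    ... | yes Des-q | _ = Des-q
    ... | no ¬Des-q | inj₂ (_ , Des-q) = ⊥-elim (¬Des-q Des-q)
    ... | no ¬Des-q | inj₁ p≡b = ⊥-elim (u⊭φ (subst Des (ev-[]-≡ τ-exact φ) (sat _ (inj₂ refl))))
      where
      τ-exact : ∀ x → ev w′ (τ x) ≡ u x
      τ-exact x = trans (τ-val₂ w′ x) (⌜∣⌝-exact (u-LP x) (w-B2 x) p≡b ¬Des-q)

  ⊬ECQ⇒≤LP : ¬ (ECQ-premises ⊢[ L ] q) → L ≤L LP
  ⊬ECQ⇒≤LP ⊬ECQ Γ φ ⊢φ = from (LP⇔⊨ {Γ} {φ}) λ u u-LP sat →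
    decidable-stable (Des? (ev u φ)) λ u⊭φ → ⊬ECQ (LP-refutable⇒⊢ECQ ⊢φ ((u-LP , sat) , u⊭φ))

  ⊢ECQ⇒ECQ≤ : ECQ-premises ⊢[ L ] q → ECQ ≤L L
  ⊢ECQ⇒ECQ≤ ⊢ECQ = Least-≤ L λ { (inj₁ ⊢BD) → BD≤L _ _ ⊢BD ; (inj₂ (refl , lift refl)) → ⊢ECQ }

_[_≔_] : (ℕ → V4) → ℕ → V4 → ℕ → V4
(g [ k ≔ a ]) x with x ≟ k
... | yes _ = a
... | no _ = g x

≔-same : ∀ g k → (g [ k ≔ a ]) k ≡ a
≔-same g k with k ≟ k
... | yes _ = refl
... | no k≢k = ⊥-elim (k≢k refl)

≔-other : ∀ g {k x} → x ≢ k → (g [ k ≔ a ]) x ≡ g x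
≔-other g {k} {x} x≢k with x ≟ k
... | yes x≡k = ⊥-elim (x≢k x≡k)
... | no _ = refl

≔-agrees : ∀ {g k} → (∀ x → x < k → u x ≡ g x) → ∀ x → x < suc k → u x ≡ (g [ k ≔ u k ]) x
≔-agrees {u} {g} u≡g x x<1+k with m<1+n⇒m<n∨m≡n x<1+k
... | inj₁ x<k = trans (u≡g x x<k) (sym (≔-other g (<⇒≢ x<k)))
... | inj₂ refl = sym (≔-same g x)

all₄ : List V4
all₄ = ⊥v ∷ nv ∷ bv ∷ ⊤v ∷ []

⋃₄ : (V4 → List Fm) → List Fm
⋃₄ Γs = concatMap Γs all₄

∈-⋃₄ : ∀ Γs a → ψ ∈ Γs a → ψ ∈ ⋃₄ Γs
∈-⋃₄ Γs ⊥v m = ∈-concatMap⁺ Γs {all₄} (here m)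
∈-⋃₄ Γs nv m = ∈-concatMap⁺ Γs {all₄} (there (here m))
∈-⋃₄ Γs bv m = ∈-concatMap⁺ Γs {all₄} (there (there (here m)))
∈-⋃₄ Γs ⊤v m = ∈-concatMap⁺ Γs {all₄} (there (there (there (here m))))

⋃₄-⊆ : ∀ Γs → (∀ a → (_∈ Γs a) ⊆ Γ) → (_∈ ⋃₄ Γs) ⊆ Γ
⋃₄-⊆ Γs Γs⊆Γ ψ m = let (a , m′) = satisfied (∈-concatMap⁻ Γs {all₄} m) in Γs⊆Γ a ψ m′

module Classical (em : ExcludedMiddle (lsuc 0ℓ)) where

  dne₁ : {A : Set₁} → ¬ ¬ A → A
  dne₁ = decidable-stable em

  em₀ : ExcludedMiddle 0ℓ
  em₀ = map′ lower lift em

  dne : {A : Set} → ¬ ¬ A → A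
  dne = decidable-stable em₀

  refutation : ¬ Entails S F Γ φ → ∃ λ u → Refutes S F u Γ φ
  refutation ⊭φ = dne λ none → ⊭φ λ u Su sat → dne λ u⊭φ → none (u , (Su , sat) , u⊭φ)

  module Compactness (S F : V4 → Set) {Γ : FmSet} {φ : Fm} where

    Refutes-below : ℕ → (ℕ → V4) → List Fm → Set
    Refutes-below k g Γ₀ = Σ (ℕ → V4) λ u → (∀ x → x < k → u x ≡ g x) × Refutes S F u (_∈ Γ₀) φ

    Extendable : ℕ → (ℕ → V4) → Set
    Extendable k g = ∀ Γ₀ → (_∈ Γ₀) ⊆ Γ → Refutes-below k g Γ₀

    obstruction : ∀ {k g} → ¬ Extendable k g → ∃ λ Γ₀ → (_∈ Γ₀) ⊆ Γ × ¬ Refutes-below k g Γ₀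
    obstruction ¬ext = dne λ none → ¬ext λ Γ₀ Γ₀⊆Γ → dne λ ¬ref → none (Γ₀ , Γ₀⊆Γ , ¬ref)

    -- If each value a at k had a finite obstruction Γs a, a refutation of ⋃₄ Γs extending g below k
    -- would refute the obstruction of its own value at k.
    extend : ∀ {k g} → Extendable k g → ∃ λ a → Extendable (suc k) (g [ k ≔ a ])
    extend {k} {g} ext = dne λ stuck →
      let obstructions = λ a → obstruction {suc k} {g [ k ≔ a ]} λ ext′ → stuck (a , ext′)
          Γs = λ a → proj₁ (obstructions a)
          (u , u≡g , (Su , u-Γs) , u⊭φ) = ext (⋃₄ Γs) (⋃₄-⊆ Γs λ a → proj₁ (proj₂ (obstructions a)))
      in proj₂ (proj₂ (obstructions (u k))) (u , ≔-agrees u≡g , (Su , λ ψ → u-Γs ψ ∘ ∈-⋃₄ Γs (u k)) , u⊭φ)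

    module _ (no-finite-entailment : ¬ ∃ λ Γ₀ → (_∈ Γ₀) ⊆ Γ × Entails S F (_∈ Γ₀) φ) where

      extendable-0 : ∀ g → Extendable 0 g
      extendable-0 g Γ₀ Γ₀⊆Γ = dne λ none →
        no-finite-entailment (Γ₀ , Γ₀⊆Γ , λ u Su sat → dne λ u⊭φ → none (u , (λ _ ()) , (Su , sat) , u⊭φ))

      path : ∀ k → ∃ (Extendable k)
      path zero = (λ _ → ⊥v) , extendable-0 _
      path (suc k) = let (g , ext) = path k ; (a , ext′) = extend ext in g [ k ≔ a ] , ext′

      limit : ℕ → V4
      limit x = proj₁ (path (suc x)) x

      path-limit : ∀ k x → x < k → proj₁ (path k) x ≡ limit x
      path-limit (suc k) x x<1+k =
        [ (λ x<k → trans (≔-other (proj₁ (path k)) (<⇒≢ x<k)) (path-limit k x x<k)) , (λ { refl → refl }) ]′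
          (m<1+n⇒m<n∨m≡n x<1+k)

      refutes-near-limit : ∀ k Γ₀ → (_∈ Γ₀) ⊆ Γ → Refutes-below k limit Γ₀
      refutes-near-limit k Γ₀ Γ₀⊆Γ =
        let (u , u≡path , refutes) = proj₂ (path k) Γ₀ Γ₀⊆Γ
        in u , (λ x x<k → trans (u≡path x x<k) (path-limit k x x<k)) , refutes

      limit-refutes : Refutes S F limit Γ φ
      limit-refutes = (S-limit , Γ-limit) , limit⊭φ
        where
        S-limit : ∀ x → S (limit x)
        S-limit x = let (u , u≡ , (Su , _) , _) = refutes-near-limit (suc x) [] (λ _ ())
                    in subst S (u≡ x (n<1+n x)) (Su x)
        Γ-limit : ∀ ψ → Γ ψ → F (ev limit ψ)
        Γ-limit ψ ψ∈Γ =
          let (u , u≡ , (_ , u-ψ) , _) = refutes-near-limit (bound ψ) (ψ ∷ []) λ { _ (here refl) → ψ∈Γ }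
          in subst F (ev-cong ψ u≡) (u-ψ ψ (here refl))
        limit⊭φ : ¬ F (ev limit φ)
        limit⊭φ = let (u , u≡ , _ , u⊭φ) = refutes-near-limit (bound φ) [] (λ _ ())
                  in u⊭φ ∘ subst F (sym (ev-cong φ u≡))

    compactness : Entails S F Γ φ → ∃ λ Γ₀ → (_∈ Γ₀) ⊆ Γ × Entails S F (_∈ Γ₀) φ
    compactness Γ⊨φ = dne λ none →
      let ((S-limit , Γ-limit) , limit⊭φ) = limit-refutes none in limit⊭φ (Γ⊨φ _ S-limit Γ-limit)

  open Compactness using (compactness)

  Least-valid-or-contradictory : (∀ {Γ φ} → R Γ φ → Γ ⊢[ X ] φ ⊎ Contradictory X Γ) →
                                 Γ ⊢[ Least R ] φ → Γ ⊢[ X ] φ ⊎ Contradictory X Γ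
  Least-valid-or-contradictory {R} {X} h = go
    where
    go : Cl R Γ φ → Γ ⊢[ X ] φ ⊎ Contradictory X Γ
    go (base r) = h r
    go (refl' x) = inj₁ (reflexivity X x)
    go (mono Γ⊆Δ d) = ⊎-map (monotonicity X Γ⊆Δ) (contradictory-cut X λ ψ x → reflexivity X (Γ⊆Δ ψ x)) (go d)
    go {Γ} (cut' ds d) with em {Contradictory X Γ}
    ... | yes contradictory = inj₂ contradictory
    ... | no consistent = ⊎-map (cut X ds′) (contradictory-cut X ds′) (go d)
      where
      ds′ : ∀ ψ → _ → Γ ⊢[ X ] ψ
      ds′ ψ x = [ id , ⊥-elim ∘ consistent ]′ (go (ds ψ x))
    go (sub' σ d) = ⊎-map (structural X σ) (contradictory-sub X σ) (go d)

  ECQ-valid-or-contradictory : Γ ⊢[ ECQ ] φ → Γ ⊢[ BD ] φ ⊎ Contradictory BD Γ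
  ECQ-valid-or-contradictory = Least-valid-or-contradictory {X = BD} λ
    { (inj₁ ⊢BD) → inj₁ ⊢BD
    ; (inj₂ (refl , lift refl)) → inj₂ (p , reflexivity BD (inj₁ refl) , reflexivity BD (inj₂ refl)) }

  LP∨ECQ-valid-or-contradictory : Γ ⊢[ LP ∨L ECQ ] φ → Γ ⊢[ LP ] φ ⊎ Contradictory LP Γ
  LP∨ECQ-valid-or-contradictory = Least-valid-or-contradictory {X = LP} λ where
    (inj₁ ⊢LP) → inj₁ ⊢LP
    {Γ} {φ} (inj₂ ⊢ECQ) → ⊎-map (BD≤LP Γ φ) (contradictory-≤ {BD} {LP} BD≤LP) (ECQ-valid-or-contradictory ⊢ECQ)

  DS∉LP∨ECQ : ¬ (DS-premises ⊢[ LP ∨L ECQ ] q)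
  DS∉LP∨ECQ ⊢q with LP∨ECQ-valid-or-contradictory ⊢q
  ... | inj₁ ⊢LP = DS∉LP ⊢LP
  ... | inj₂ (α , ⊢α , ⊢∼α) =
    B2-consistent (ev-B2 {u = λ _ → ⊤v} (λ _ → inj₂ refl) α) (all-⊤⊨ {α} ⊢α , all-⊤⊨ {∼ α} ⊢∼α)
    where
    all-⊤⊨ : DS-premises ⊢[ LP ] χ → Des (ev (λ _ → ⊤v) χ)
    all-⊤⊨ {χ} ⊢χ = to (LP⇔⊨ {DS-premises} {χ}) ⊢χ (λ _ → ⊤v) (λ _ → inj₂ (inj₂ refl))
                      λ { _ (inj₁ refl) → inj₂ refl ; _ (inj₂ refl) → inj₂ refl }

  ≢BD⇒⊢Kleene : ∀ L → BD ≤L L → ¬ (L ≐L BD) → ECQ-premises ⊢[ L ] q ⋁ ∼ q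
  ≢BD⇒⊢Kleene L BD≤L L≢BD =
    let (_ , _ , ⊢φ , u , refutes) = refuted-rule in BD-refutable⇒⊢Kleene L BD≤L {u = u} ⊢φ refutes
    where
    refuted-rule : Σ FmSet λ Γ → Σ Fm λ φ → Γ ⊢[ L ] φ × ∃ λ u → Refutes (λ _ → ⊤) Des u Γ φ
    refuted-rule = dne₁ λ none → L≢BD ((λ Γ φ ⊢φ → from (BD⇔⊨ {Γ} {φ}) λ u _ sat →
      decidable-stable (Des? (ev u φ)) λ u⊭φ → none (Γ , φ , ⊢φ , u , ((λ _ → tt) , sat) , u⊭φ)) , BD≤L)

  -- From ECQ-contradictory premises Kleene's rule derives every β ∨ ∼β, under which BD₄ behaves like LP₃.
  ⊢Kleene⇒LP∩ECQ≤ : ∀ L → BD ≤L L → ECQ-premises ⊢[ L ] q ⋁ ∼ q → (LP ∩L ECQ) ≤L L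
  ⊢Kleene⇒LP∩ECQ≤ L BD≤L ⊢Kleene Γ φ (⊢LP , ⊢ECQ) with ECQ-valid-or-contradictory ⊢ECQ
  ... | inj₁ ⊢BD = BD≤L Γ φ ⊢BD
  ... | inj₂ (α , ⊢α , ⊢∼α) =
    cut-∪ L excluded-middle (by-BD L BD≤L (⊨LP⇒⊨BD-with-excluded-middle {Γ} {φ} (to (LP⇔⊨ {Γ} {φ}) ⊢LP)))
    where
    excluded-middle : ∀ ψ → Excluded-middle ψ → Γ ⊢[ L ] ψ
    excluded-middle _ (β , refl) = apply₂ L α β ⊢Kleene (BD≤L Γ α ⊢α) (BD≤L Γ (∼ α) ⊢∼α)

  ⊢DS⇒ETL≤ : ∀ L → BD ≤L L → DS-premises ⊢[ L ] q → ETL ≤L L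
  ⊢DS⇒ETL≤ L BD≤L ⊢DS Γ φ ⊢φ =
    let (Γ₀ , Γ₀⊆Γ , Γ₀⊨φ) = compactness (λ _ → ⊤) (_≡ ⊤v) {Γ} {φ} (to (ETL⇔⊨ {Γ} {φ}) ⊢φ)
    in apply₂ L (conj Γ₀) φ ⊢DS (by-BD L BD≤L {Γ} {conj Γ₀} (⊨conj Γ₀⊆Γ))
                                (by-BD L BD≤L {Γ} {∼ conj Γ₀ ⋁ φ} (⊨ETL⇒⊨∼conj∨ {Γ} {φ} Γ₀⊆Γ Γ₀⊨φ))

  ⊬DS⇒≤LP∨ECQ : ∀ L → BD ≤L L → ¬ (DS-premises ⊢[ L ] q) → L ≤L (LP ∨L ECQ)
  ⊬DS⇒≤LP∨ECQ L BD≤L ⊬DS Γ φ ⊢φ with em₀ {Γ ⊨LP φ} | em₀ {∃ λ w → Model InB2 (_≡ ⊤v) w Γ}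
  ... | yes Γ⊨φ | _ = LP≤LP∨ECQ Γ φ (from (LP⇔⊨ {Γ} {φ}) Γ⊨φ)
  ... | no Γ⊭φ | yes (w , w-model) =
    let (u , u-refutes) = refutation {S = InLP} {F = Des} {Γ} {φ} Γ⊭φ
    in ⊥-elim (⊬DS (LP-refutable+CL-model⇒⊢DS L BD≤L {u = u} {w = w} ⊢φ u-refutes w-model))
  ... | no _ | no unsatisfiable =
    let (Γ₀ , Γ₀⊆Γ , Γ₀⊨⊥) = compactness InB2 (_≡ ⊤v) {Γ} {⊥f} λ w w-B2 sat → ⊥-elim (unsatisfiable (w , w-B2 , sat))
    in explode (LP ∨L ECQ) (base (inj₂ ECQ∈ECQ))
               (contradictory-≤ {LP} {LP ∨L ECQ} LP≤LP∨ECQ (CL-unsatisfiable⇒LP-contradictory {Γ} Γ₀⊆Γ Γ₀⊨⊥))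

  classification : ∀ L → NonTrivial L → ProperExtension BD L →
                   L ∈[ LP ∩L ECQ , LP ] ⊎ L ∈[ ECQ , LP ∨L ECQ ] ⊎ L ∈[ ETL , CL ]
  classification L nontrivial (BD≤L , L≢BD) with em {ECQ-premises ⊢[ L ] q} | em {DS-premises ⊢[ L ] q}
  ... | no ⊬ECQ | _ = inj₁ (⊢Kleene⇒LP∩ECQ≤ L BD≤L (≢BD⇒⊢Kleene L BD≤L L≢BD) , ⊬ECQ⇒≤LP L BD≤L ⊬ECQ)
  ... | yes ⊢ECQ | no ⊬DS = inj₂ (inj₁ (⊢ECQ⇒ECQ≤ L BD≤L ⊢ECQ , ⊬DS⇒≤LP∨ECQ L BD≤L ⊬DS))
  ... | yes _ | yes ⊢DS = inj₂ (inj₂ (⊢DS⇒ETL≤ L BD≤L ⊢DS , nontrivial⇒≤CL L BD≤L nontrivial))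

theorem6p9 : ExcludedMiddle (lsuc 0ℓ) →
    ((∀ L → ¬ (L ∈[ LP ∩L ECQ , LP ] × L ∈[ ECQ , LP ∨L ECQ ]))
     × (∀ L → ¬ (L ∈[ LP ∩L ECQ , LP ] × L ∈[ ETL , CL ]))
     × (∀ L → ¬ (L ∈[ ECQ , LP ∨L ECQ ] × L ∈[ ETL , CL ])))
    × (∀ L → NonTrivial L → ProperExtension BD L →
         L ∈[ LP ∩L ECQ , LP ] ⊎ L ∈[ ECQ , LP ∨L ECQ ] ⊎ L ∈[ ETL , CL ])
theorem6p9 em =
  ( (λ L ((_ , L≤LP) , (ECQ≤L , _)) → ECQ∉LP (L≤LP _ _ (ECQ≤L _ _ ECQ∈ECQ)))
  , (λ L ((_ , L≤LP) , (ETL≤L , _)) → DS∉LP (L≤LP _ _ (ETL≤L DS-premises q DS∈ETL)))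
  , (λ L ((_ , L≤LP∨ECQ) , (ETL≤L , _)) → DS∉LP∨ECQ (L≤LP∨ECQ _ _ (ETL≤L DS-premises q DS∈ETL))) )
  , classification
  where open Classical em
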